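{- For an integer $N\ge1$, define rational functions $T_N=1+xq^N$ and, for $r=N-1,N-2,\dots,1$, $T_r=1+xq^r-\dfrac{x^2q^{2r+1}}{T_{r+1}}$. Then \[ \frac{F_N(0,1,1;x)}{F_{N-1}(0,1,1;xq)} = T_1, \] i.e. $\dfrac{F_N(0,1,1;x)}{F_{N-1}(0,1,1;xq)}=1+xq-\cfrac{x^2q^3}{1+xq^2-\cfrac{x^2q^5}{\ddots-\cfrac{x^2q^{2N-1}}{1+xq^N}}}$.
   Context: Gaussian binomial: ${A\brack B}_q=0$ if $B>A$ or $B<0$, otherwise $\frac{(q;q)_A}{(q;q)_B(q;q)_{A-B}}$, with $(a;q)_n=\prod_{t=0}^{n-1}(1-aq^t)$. For integers $N$, $F_N(0,1,1;x)=0$ if $N<0$, and for $N\ge0$ \[ F_N(0,1,1;x)=\sum_{m,n\ge0}(-1)^n q^{\binom{3n+1}{2}+m^2+3mn}x^{m+3n}{N-3n-m+1\brack m}_q{N-2n-m\brack n}_{q^3}; \] $F_{N-1}(0,1,1;xq)$ means $x$ replaced by $xq$. -}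

module Defs where

open import Data.Nat as ℕ using (ℕ; zero; suc)
open import Data.Nat.Properties using (_<?_)
open import Data.Nat.Combinatorics using (_C_)
open import Data.Integer as ℤ using (ℤ; +_; -[1+_])
open import Data.Rational using (ℚ; 0ℚ; 1ℚ; _+_; _*_; _-_; -_; _÷_; ≢-nonZero)
open import Data.Rational.Properties using (_≟_)
import Data.List
open import Data.List using (List; map; upTo)
open import Data.Rational.Properties using ()
sum : List ℚ → ℚ
sum = Data.List.foldr _+_ 0ℚ
open import Relation.Nullary using (yes; no)

infixr 8 _^_
_^_ : ℚ → ℕ → ℚ
p ^ zero  = 1ℚ
p ^ suc n = p * (p ^ n)

-- total division on ℚ (p / 0 := 0); only used where the denominator
-- is assumed (or guaranteed) nonzero
infixl 7 _/'_
_/'_ : ℚ → ℚ → ℚ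
p /' r with r ≟ 0ℚ
... | yes _  = 0ℚ
... | no r≢0 = _÷_ p r {{≢-nonZero r≢0}}

poch : ℚ → ℚ → ℕ → ℚ
poch a q zero    = 1ℚ
poch a q (suc n) = poch a q n * (1ℚ - a * q ^ n)

gbin : ℚ → ℤ → ℤ → ℚ
gbin q A -[1+ _ ] = 0ℚ
gbin q -[1+ _ ] (+ b) = 0ℚ
gbin q (+ a) (+ b) with a <? b
... | yes _ = 0ℚ
... | no _  = poch q q a /' (poch q q b * poch q q (a ℕ.∸ b))

ℤ[_] : ℕ → ℤ
ℤ[ n ] = + n

-- F_N(0,1,1;x) for N ≥ 0 (N a natural number):
--   Σ_{m,n ≥ 0} (-1)^n q^{C(3n+1,2) + m^2 + 3mn} x^{m+3n}
--        [N-3n-m+1 over m]_q [N-2n-m over n]_{q^3}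
-- The sum is finite: for m > N+1 the first Gaussian binomial vanishes
-- (its top is < m), for n > N+1 the second vanishes (top < n); so we
-- sum over 0 ≤ m, n ≤ N+1 exactly.
Fterm : ℕ → ℚ → ℚ → ℕ → ℕ → ℚ
Fterm N q x m n =
  ((- 1ℚ) ^ n) * (q ^ (((3 ℕ.* n ℕ.+ 1) C 2) ℕ.+ m ℕ.* m ℕ.+ 3 ℕ.* m ℕ.* n))
    * (x ^ (m ℕ.+ 3 ℕ.* n))
    * gbin q (+ N ℤ.- + (3 ℕ.* n) ℤ.- + m ℤ.+ + 1) (+ m)
    * gbin (q ^ 3) (+ N ℤ.- + (2 ℕ.* n) ℤ.- + m) (+ n)

F : ℕ → ℚ → ℚ → ℚ
F N q x = sum (map (λ m → sum (map (λ n → Fterm N q x m n) (upTo (suc (suc N))))) (upTo (suc (suc N))))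

-- Continued fraction: cf x q r k is T_r when r + k = N, i.e.
--   cf x q r 0       = 1 + x q^r                       (T_N)
--   cf x q r (k + 1) = 1 + x q^r - x^2 q^(2r+1) / cf x q (r+1) k
cf : ℚ → ℚ → ℕ → ℕ → ℚ
cf x q r zero    = 1ℚ + x * q ^ r
cf x q r (suc k) = (1ℚ + x * q ^ r) - (x ^ 2 * q ^ (2 ℕ.* r ℕ.+ 1)) /' cf x q (suc r) k

T : ℕ → ℚ → ℚ → ℕ → ℚ
T N x q r = cf x q r (N ℕ.∸ r)

module Submission where

-- The summand of F_N is a product of a q-binomial and a q³-binomial, and both satisfy
-- q-Pascal.  Writing Φ(A, B) for the same double sum with tops A − 3n − m and B − 2n − m
-- (and twisted by q^(im + jn)), q-Pascal in the first binomial splits Φ(A + 1, A) into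
-- Φ(A, A) and an index-shifted Φ(A − 1, A − 1), and q-Pascal in the second splits
-- Φ(A + 1, A + 1) into Φ(A + 1, A) and a shifted Φ(A − 2, A − 2).  Three applications of
-- the first rule and one of the second make the auxiliary sums cancel and give
--   F_{N+1}(x) = (1 + xq) F_N(xq) − x²q³ F_{N−1}(xq²).
-- With x_s = x q^s this says that R_s = F_{k+1}(x_s) / F_k(x_{s+1}) satisfies
-- R_s = 1 + x_{s+1} − x_s² q³ / R_{s+1}, which unfolds into the continued fraction T_1.

open import Data.Nat as ℕ using (ℕ; zero; suc; _≤_; _<_; _∸_)
import Data.Nat.Properties as ℕP
import Data.Nat.Tactic.RingSolver as ℕ-Solver
open import Data.Nat.Combinatorics using (_C_; nC1≡n; nCk+nC[k+1]≡[n+1]C[k+1])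
open import Data.Integer as ℤ using (ℤ; +_; -[1+_]; 1ℤ; -1ℤ)
import Data.Integer.Properties as ℤP
import Data.Integer.Tactic.RingSolver as ℤ-Solver
open import Data.Rational as ℚ
  using (ℚ; 0ℚ; 1ℚ; _+_; _*_; _-_; -_; 1/_; ≢-nonZero; NonNegative; nonNegative; nonPositive)
open import Data.Rational.Properties
open import Data.Sum using (_⊎_; inj₁; inj₂; [_,_]′)
open import Data.Empty using (⊥-elim)
open import Data.List using (upTo; applyUpTo; map)
open import Function using (_∘_)
open import Level using (0ℓ)
open import Relation.Binary.PropositionalEquality
open import Relation.Binary.Definitions using (tri<; tri≈; tri>)
open import Relation.Nullary using (yes; no)
open import Relation.Nullary.Decidable using (dec⇒maybe)
open import Tactic.RingSolver using (solve-∀)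
import Tactic.RingSolver.Core.AlmostCommutativeRing as ACR

open import Defs

ℚ-ring : ACR.AlmostCommutativeRing 0ℓ 0ℓ
ℚ-ring = ACR.fromCommutativeRing +-*-commutativeRing (λ p → dec⇒maybe (0ℚ ≟ p))

-- Arithmetic in ℚ

^-+ : ∀ p a b → p ^ (a ℕ.+ b) ≡ p ^ a * p ^ b
^-+ p zero    b = sym (*-identityˡ _)
^-+ p (suc a) b = trans (cong (p *_) (^-+ p a b)) (sym (*-assoc p _ _))

^-* : ∀ p a b → p ^ (a ℕ.* b) ≡ (p ^ a) ^ b
^-* p a zero    = cong (p ^_) (ℕP.*-zeroʳ a)
^-* p a (suc b) = begin
  p ^ (a ℕ.* suc b)       ≡⟨ cong (p ^_) (ℕP.*-suc a b) ⟩
  p ^ (a ℕ.+ a ℕ.* b)     ≡⟨ ^-+ p a (a ℕ.* b) ⟩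
  p ^ a * p ^ (a ℕ.* b)   ≡⟨ cong (p ^ a *_) (^-* p a b) ⟩
  p ^ a * (p ^ a) ^ b     ∎
  where open ≡-Reasoning

*-^ : ∀ p r k → (p * r) ^ k ≡ p ^ k * r ^ k
*-^ p r zero    = refl
*-^ p r (suc k) = trans (cong (p * r *_) (*-^ p r k)) (interchange p r (p ^ k) (r ^ k))
  where
  interchange : ∀ a b c d → a * b * (c * d) ≡ a * c * (b * d)
  interchange = solve-∀ ℚ-ring

/'-by-≢0 : ∀ p r (r≢0 : r ≢ 0ℚ) → p /' r ≡ p * (1/ r) {{≢-nonZero r≢0}}
/'-by-≢0 p r r≢0 with r ≟ 0ℚ
... | yes r≡0 = ⊥-elim (r≢0 r≡0)
... | no _    = refl

/'-*-cancel : ∀ p r → r ≢ 0ℚ → (p /' r) * r ≡ p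
/'-*-cancel p r r≢0 = begin
  (p /' r) * r        ≡⟨ cong (_* r) (/'-by-≢0 p r r≢0) ⟩
  p * (1/ r) * r      ≡⟨ *-assoc p _ r ⟩
  p * ((1/ r) * r)    ≡⟨ cong (p *_) (*-inverseˡ r) ⟩
  p * 1ℚ              ≡⟨ *-identityʳ p ⟩
  p                   ∎
  where
  open ≡-Reasoning
  instance _ = ≢-nonZero r≢0

/'-unique : ∀ p r s → r ≢ 0ℚ → p ≡ s * r → p /' r ≡ s
/'-unique p r s r≢0 p≡sr = begin
  p /' r              ≡⟨ /'-by-≢0 p r r≢0 ⟩
  p * (1/ r)          ≡⟨ cong (_* (1/ r)) p≡sr ⟩
  s * r * (1/ r)      ≡⟨ *-assoc s r _ ⟩
  s * (r * (1/ r))    ≡⟨ cong (s *_) (*-inverseʳ r) ⟩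
  s * 1ℚ              ≡⟨ *-identityʳ s ⟩
  s                   ∎
  where
  open ≡-Reasoning
  instance _ = ≢-nonZero r≢0

0/' : ∀ r → 0ℚ /' r ≡ 0ℚ
0/' r with r ≟ 0ℚ
... | yes _   = refl
... | no r≢0  = *-zeroˡ ((1/ r) {{≢-nonZero r≢0}})

*≡0 : ∀ a b → a * b ≡ 0ℚ → a ≡ 0ℚ ⊎ b ≡ 0ℚ
*≡0 a b ab≡0 with a ≟ 0ℚ
... | yes a≡0 = inj₁ a≡0
... | no a≢0  = inj₂ (begin
  b              ≡⟨ /'-unique (a * b) a b a≢0 (*-comm a b) ⟨
  (a * b) /' a   ≡⟨ cong (_/' a) ab≡0 ⟩
  0ℚ /' a        ≡⟨ 0/' a ⟩
  0ℚ             ∎)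
  where open ≡-Reasoning

*-≢0 : ∀ {a b} → a ≢ 0ℚ → b ≢ 0ℚ → a * b ≢ 0ℚ
*-≢0 {a} {b} a≢0 b≢0 ab≡0 = [ a≢0 , b≢0 ]′ (*≡0 a b ab≡0)

-≡0⇒≡ : ∀ {a b} → a - b ≡ 0ℚ → a ≡ b
-≡0⇒≡ {a} {b} a-b≡0 = begin
  a             ≡⟨ sub-add a b ⟨
  a - b + b     ≡⟨ cong (_+ b) a-b≡0 ⟩
  0ℚ + b        ≡⟨ +-identityˡ b ⟩
  b             ∎
  where
  open ≡-Reasoning
  sub-add : ∀ a b → a - b + b ≡ a
  sub-add = solve-∀ ℚ-ring

square-nonNeg : ∀ p → NonNegative (p * p)
square-nonNeg p with ≤-total 0ℚ p
... | inj₁ p≥0 = nonNeg*nonNeg⇒nonNeg p {{nonNegative p≥0}} p {{nonNegative p≥0}}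
... | inj₂ p≤0 = nonPos*nonPos⇒nonPos p {{nonPositive p≤0}} p {{nonPositive p≤0}}

module _ (p : ℚ) .{{_ : NonNegative p}} where

  ^-≤-base : p ℚ.≤ 1ℚ → ∀ k → p ^ suc k ℚ.≤ p
  ^-≤-base p≤1 zero    = ≤-reflexive (*-identityʳ p)
  ^-≤-base p≤1 (suc k) = begin
    p * p ^ suc k   ≤⟨ *-monoˡ-≤-nonNeg p (^-≤-base p≤1 k) ⟩
    p * p           ≤⟨ *-monoˡ-≤-nonNeg p p≤1 ⟩
    p * 1ℚ          ≡⟨ *-identityʳ p ⟩
    p               ∎
    where open ≤-Reasoning

  ^-≥-base : 1ℚ ℚ.≤ p → ∀ k → p ℚ.≤ p ^ suc k
  ^-≥-base 1≤p zero    = ≤-reflexive (sym (*-identityʳ p))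
  ^-≥-base 1≤p (suc k) = begin
    p               ≡⟨ *-identityʳ p ⟨
    p * 1ℚ          ≤⟨ *-monoˡ-≤-nonNeg p 1≤p ⟩
    p * p           ≤⟨ *-monoˡ-≤-nonNeg p (^-≥-base 1≤p k) ⟩
    p * p ^ suc k   ∎
    where open ≤-Reasoning

  nonNeg-^-≢1 : p ≢ 1ℚ → ∀ k → p ^ suc k ≢ 1ℚ
  nonNeg-^-≢1 p≢1 k pᵏ≡1 with <-cmp p 1ℚ
  ... | tri< p<1 _ _ = <-irrefl pᵏ≡1 (≤-<-trans (^-≤-base (<⇒≤ p<1) k) p<1)
  ... | tri≈ _ p≡1 _ = p≢1 p≡1
  ... | tri> _ _ p>1 = <-irrefl (sym pᵏ≡1) (<-≤-trans p>1 (^-≥-base (<⇒≤ p>1) k))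

square-≢1 : ∀ q → q ≢ 1ℚ → q ≢ - 1ℚ → q * q ≢ 1ℚ
square-≢1 q q≢1 q≢-1 q²≡1 = [ q≢1 ∘ -≡0⇒≡ , q≢-1 ∘ -≡0⇒≡ ]′ (*≡0 (q - 1ℚ) (q + 1ℚ) (begin
  (q - 1ℚ) * (q + 1ℚ)   ≡⟨ difference-of-squares q ⟩
  q * q - 1ℚ            ≡⟨ cong (_- 1ℚ) q²≡1 ⟩
  1ℚ - 1ℚ               ≡⟨ +-inverseʳ 1ℚ ⟩
  0ℚ                    ∎))
  where
  open ≡-Reasoning
  difference-of-squares : ∀ q → (q - 1ℚ) * (q + 1ℚ) ≡ q * q - 1ℚ
  difference-of-squares = solve-∀ ℚ-ring

^-≢1 : ∀ q → q ≢ 1ℚ → q ≢ - 1ℚ → ∀ k → q ^ suc k ≢ 1ℚ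
^-≢1 q q≢1 q≢-1 k qᵏ≡1 =
  nonNeg-^-≢1 (q * q) {{square-nonNeg q}} (square-≢1 q q≢1 q≢-1) k
    (trans (*-^ q q (suc k)) (cong₂ _*_ qᵏ≡1 qᵏ≡1))

-- Gaussian binomials

qbinom : ℚ → ℕ → ℕ → ℚ
qbinom q a       zero    = 1ℚ
qbinom q zero    (suc b) = 0ℚ
qbinom q (suc a) (suc b) = qbinom q a b + q ^ suc b * qbinom q a (suc b)

qbinom-< : ∀ q {a b} → a < b → qbinom q a b ≡ 0ℚ
qbinom-< q {zero}  {suc b} _ = refl
qbinom-< q {suc a} {suc b} (ℕ.s≤s a<b) = begin
  qbinom q a b + q ^ suc b * qbinom q a (suc b)
    ≡⟨ cong₂ (λ u v → u + q ^ suc b * v) (qbinom-< q a<b) (qbinom-< q (ℕP.m<n⇒m<1+n a<b)) ⟩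
  0ℚ + q ^ suc b * 0ℚ
    ≡⟨ vanish (q ^ suc b) ⟩
  0ℚ ∎
  where
  open ≡-Reasoning
  vanish : ∀ r → 0ℚ + r * 0ℚ ≡ 0ℚ
  vanish = solve-∀ ℚ-ring

qbinom-diag : ∀ q a → qbinom q a a ≡ 1ℚ
qbinom-diag q zero    = refl
qbinom-diag q (suc a) = begin
  qbinom q a a + q ^ suc a * qbinom q a (suc a)
    ≡⟨ cong₂ (λ u v → u + q ^ suc a * v) (qbinom-diag q a) (qbinom-< q (ℕP.n<1+n a)) ⟩
  1ℚ + q ^ suc a * 0ℚ
    ≡⟨ vanish (q ^ suc a) ⟩
  1ℚ ∎
  where
  open ≡-Reasoning
  vanish : ∀ r → 1ℚ + r * 0ℚ ≡ 1ℚ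
  vanish = solve-∀ ℚ-ring

qpoch : ℚ → ℕ → ℚ
qpoch q = poch q q

qbinom-qpoch : ∀ q b a → qbinom q (b ℕ.+ a) b * (qpoch q b * qpoch q a) ≡ qpoch q (b ℕ.+ a)
qbinom-qpoch q zero    a       = trans (*-identityˡ _) (*-identityˡ _)
qbinom-qpoch q (suc b) zero    rewrite ℕP.+-identityʳ b =
  trans (cong (_* (qpoch q (suc b) * 1ℚ)) (qbinom-diag q (suc b))) (trans (*-identityˡ _) (*-identityʳ _))
qbinom-qpoch q (suc b) (suc a) = begin
  (g₁ + u * g₂) * (p_b * (1ℚ - u) * (p_a * (1ℚ - v)))
    ≡⟨ regroup g₁ g₂ u v p_b p_a ⟩
  (1ℚ - u) * (g₁ * (p_b * (p_a * (1ℚ - v)))) + u * (1ℚ - v) * (g₂ * (p_b * (1ℚ - u) * p_a))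
    ≡⟨ cong₂ (λ s t → (1ℚ - u) * s + u * (1ℚ - v) * t) (qbinom-qpoch q b (suc a)) IH ⟩
  (1ℚ - u) * P + u * (1ℚ - v) * P
    ≡⟨ collect u v P ⟩
  P * (1ℚ - u * v)
    ≡⟨ cong (λ w → P * (1ℚ - w)) (^-+ q (suc b) (suc a)) ⟨
  P * (1ℚ - q ^ (suc b ℕ.+ suc a))  ∎
  where
  open ≡-Reasoning
  g₁ g₂ u v p_b p_a P : ℚ
  g₁ = qbinom q (b ℕ.+ suc a) b
  g₂ = qbinom q (b ℕ.+ suc a) (suc b)
  u = q ^ suc b
  v = q ^ suc a
  p_b = qpoch q b
  p_a = qpoch q a
  P = qpoch q (b ℕ.+ suc a)
  IH : g₂ * (p_b * (1ℚ - u) * p_a) ≡ P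
  IH rewrite ℕP.+-suc b a = qbinom-qpoch q (suc b) a
  regroup : ∀ g₁ g₂ u v p_b p_a →
    (g₁ + u * g₂) * (p_b * (1ℚ - u) * (p_a * (1ℚ - v))) ≡
    (1ℚ - u) * (g₁ * (p_b * (p_a * (1ℚ - v)))) + u * (1ℚ - v) * (g₂ * (p_b * (1ℚ - u) * p_a))
  regroup = solve-∀ ℚ-ring
  collect : ∀ u v P → (1ℚ - u) * P + u * (1ℚ - v) * P ≡ P * (1ℚ - u * v)
  collect = solve-∀ ℚ-ring

qpoch-≢0 : ∀ q → (∀ k → q ^ suc k ≢ 1ℚ) → ∀ n → qpoch q n ≢ 0ℚ
qpoch-≢0 q q≢root zero    = 1≢0
qpoch-≢0 q q≢root (suc n) = *-≢0 (qpoch-≢0 q q≢root n) (λ 1-qⁿ≡0 → q≢root n (sym (-≡0⇒≡ 1-qⁿ≡0)))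

gbin-qbinom : ∀ q → (∀ k → q ^ suc k ≢ 1ℚ) → ∀ a b → gbin q (+ a) (+ b) ≡ qbinom q a b
gbin-qbinom q q≢root a b with a ℕP.<? b
... | yes a<b = sym (qbinom-< q a<b)
... | no a≮b  = /'-unique _ _ _ (*-≢0 (qpoch-≢0 q q≢root b) (qpoch-≢0 q q≢root (a ∸ b))) (sym (
  subst (λ c → qbinom q c b * (qpoch q b * qpoch q (a ∸ b)) ≡ qpoch q c)
        (ℕP.m+[n∸m]≡n (ℕP.≮⇒≥ a≮b)) (qbinom-qpoch q b (a ∸ b))))

qbinomℤ : ℚ → ℤ → ℕ → ℚ
qbinomℤ q (+ a)    b = qbinom q a b
qbinomℤ q -[1+ _ ] b = 0ℚ

gbin-qbinomℤ : ∀ q → (∀ k → q ^ suc k ≢ 1ℚ) → ∀ A b → gbin q A (+ b) ≡ qbinomℤ q A b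
gbin-qbinomℤ q q≢root (+ a)    b = gbin-qbinom q q≢root a b
gbin-qbinomℤ q q≢root -[1+ _ ] b = refl

qbinomℤ-pascal : ∀ q T b → qbinomℤ q (ℤ.suc T) (suc b) ≡ qbinomℤ q T b + q ^ suc b * qbinomℤ q T (suc b)
qbinomℤ-pascal q (+ t)          b = refl
qbinomℤ-pascal q -[1+ zero ]    b = sym (vanish (q ^ suc b))
  where
  vanish : ∀ r → 0ℚ + r * 0ℚ ≡ 0ℚ
  vanish = solve-∀ ℚ-ring
qbinomℤ-pascal q -[1+ suc t ]   b = sym (vanish (q ^ suc b))
  where
  vanish : ∀ r → 0ℚ + r * 0ℚ ≡ 0ℚ
  vanish = solve-∀ ℚ-ring

qbinomℤ-suc-zero : ∀ q T y → (T ≡ -[1+ 0 ] → y ≡ 0ℚ) → qbinomℤ q (ℤ.suc T) 0 * y ≡ qbinomℤ q T 0 * y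
qbinomℤ-suc-zero q (+ t)         y _     = refl
qbinomℤ-suc-zero q -[1+ zero ]   y y≡0   = trans (cong (1ℚ *_) (y≡0 refl)) (sym (*-zeroˡ y))
qbinomℤ-suc-zero q -[1+ suc t ]  y _     = refl

qbinomℤ-pred-diag : ∀ q n → qbinomℤ q (ℤ.pred (+ n)) n ≡ 0ℚ
qbinomℤ-pred-diag q zero    = refl
qbinomℤ-pred-diag q (suc n) = qbinom-< q (ℕP.n<1+n n)

qbinomℤ-⊖ : ∀ q {a k} b → a < k → qbinomℤ q (a ℤ.⊖ k) b ≡ 0ℚ
qbinomℤ-⊖ q {zero}  {suc k} b _               = refl
qbinomℤ-⊖ q {suc a} {suc k} b (ℕ.s≤s a<k)     =
  trans (cong (λ T → qbinomℤ q T b) (ℤP.[1+m]⊖[1+n]≡m⊖n a k)) (qbinomℤ-⊖ q b a<k)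

box : ℤ → ℕ
box (+ a)    = suc a
box -[1+ _ ] = 0

box-suc : ∀ A → box A ≤ box (ℤ.suc A)
box-suc (+ a)          = ℕP.n≤1+n (suc a)
box-suc -[1+ zero ]    = ℕ.z≤n
box-suc -[1+ suc t ]   = ℕ.z≤n

box-pred : ∀ A → box (ℤ.pred A) ≤ box A
box-pred A = subst (λ B → box (ℤ.pred A) ≤ box B) (ℤP.suc-pred A) (box-suc (ℤ.pred A))

qbinomℤ-outside-box : ∀ q A k b → box A ≤ k → qbinomℤ q (A ℤ.- + k) b ≡ 0ℚ
qbinomℤ-outside-box q (+ a)    k       b a<k = trans (cong (λ T → qbinomℤ q T b) (ℤP.m-n≡m⊖n a k)) (qbinomℤ-⊖ q b a<k)
qbinomℤ-outside-box q -[1+ a ] zero    b _   = refl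
qbinomℤ-outside-box q -[1+ a ] (suc k) b _   = refl

top-suc : ∀ A k → (1ℤ ℤ.+ A) ℤ.- k ≡ 1ℤ ℤ.+ (A ℤ.- k)
top-suc = ℤ-Solver.solve-∀

top-sucᵐ : ∀ A k m → A ℤ.- (k ℤ.+ (1ℤ ℤ.+ m)) ≡ (-1ℤ ℤ.+ A) ℤ.- (k ℤ.+ m)
top-sucᵐ = ℤ-Solver.solve-∀

top-sucⁿ₁ : ∀ A n m → (1ℤ ℤ.+ A) ℤ.- (+ 3 ℤ.* (1ℤ ℤ.+ n) ℤ.+ m) ≡ (-1ℤ ℤ.+ (-1ℤ ℤ.+ A)) ℤ.- (+ 3 ℤ.* n ℤ.+ m)
top-sucⁿ₁ = ℤ-Solver.solve-∀

top-sucⁿ₂ : ∀ A n m → A ℤ.- (+ 2 ℤ.* (1ℤ ℤ.+ n) ℤ.+ m) ≡ (-1ℤ ℤ.+ (-1ℤ ℤ.+ A)) ℤ.- (+ 2 ℤ.* n ℤ.+ m)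
top-sucⁿ₂ = ℤ-Solver.solve-∀

top₂-top₁ : ∀ A n m → A ℤ.- (+ 2 ℤ.* n ℤ.+ m) ≡ A ℤ.- (+ 3 ℤ.* n ℤ.+ m) ℤ.+ n
top₂-top₁ = ℤ-Solver.solve-∀

top-ℕ : ∀ A c n m → A ℤ.- (+ c ℤ.* + n ℤ.+ + m) ≡ A ℤ.- + (c ℕ.* n ℕ.+ m)
top-ℕ A c n m = cong (ℤ._-_ A) (sym (trans (ℤP.pos-+ (c ℕ.* n) m) (cong (ℤ._+ + m) (ℤP.pos-* c n))))

top-Fterm₁ : ∀ N t m → N ℤ.- t ℤ.- m ℤ.+ 1ℤ ≡ (1ℤ ℤ.+ N) ℤ.- (t ℤ.+ m)
top-Fterm₁ = ℤ-Solver.solve-∀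

top-Fterm₂ : ∀ N t m → N ℤ.- t ℤ.- m ≡ N ℤ.- (t ℤ.+ m)
top-Fterm₂ = ℤ-Solver.solve-∀

-- Finite sums

∑ : ℕ → (ℕ → ℚ) → ℚ
∑ zero    f = 0ℚ
∑ (suc n) f = f 0 + ∑ n (f ∘ suc)

∑-cong : ∀ n {f g : ℕ → ℚ} → (∀ i → f i ≡ g i) → ∑ n f ≡ ∑ n g
∑-cong zero    f≗g = refl
∑-cong (suc n) f≗g = cong₂ _+_ (f≗g 0) (∑-cong n (f≗g ∘ suc))

∑-+ : ∀ n f g → ∑ n (λ i → f i + g i) ≡ ∑ n f + ∑ n g
∑-+ zero    f g = refl
∑-+ (suc n) f g = trans (cong (_+_ (f 0 + g 0)) (∑-+ n (f ∘ suc) (g ∘ suc))) (interchange (f 0) (g 0) _ _)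
  where
  interchange : ∀ a b c d → a + b + (c + d) ≡ a + c + (b + d)
  interchange = solve-∀ ℚ-ring

∑-*ˡ : ∀ n c f → ∑ n (λ i → c * f i) ≡ c * ∑ n f
∑-*ˡ zero    c f = sym (*-zeroʳ c)
∑-*ˡ (suc n) c f = trans (cong (_+_ (c * f 0)) (∑-*ˡ n c (f ∘ suc))) (sym (*-distribˡ-+ c (f 0) _))

∑-zero : ∀ n f → (∀ i → f i ≡ 0ℚ) → ∑ n f ≡ 0ℚ
∑-zero zero    f f≡0 = refl
∑-zero (suc n) f f≡0 = trans (cong₂ _+_ (f≡0 0) (∑-zero n (f ∘ suc) (f≡0 ∘ suc))) (+-identityˡ 0ℚ)

∑-truncate : ∀ {K L} f → K ≤ L → (∀ i → K ≤ i → f i ≡ 0ℚ) → ∑ L f ≡ ∑ K f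
∑-truncate {zero}  {L}     f _           f≡0 = ∑-zero L f (λ i → f≡0 i ℕ.z≤n)
∑-truncate {suc K} {suc L} f (ℕ.s≤s K≤L) f≡0 =
  cong (_+_ (f 0)) (∑-truncate (f ∘ suc) K≤L (λ i K≤i → f≡0 (suc i) (ℕ.s≤s K≤i)))

∑-split-shift : ∀ L f g h c → f 0 ≡ g 0 → (∀ m → f (suc m) ≡ g (suc m) + c * h m) →
                ∑ (suc L) f ≡ ∑ (suc L) g + c * ∑ L h
∑-split-shift L f g h c f₀≡g₀ f≡g+ch = begin
  f 0 + ∑ L (f ∘ suc)                               ≡⟨ cong₂ _+_ f₀≡g₀ (∑-cong L f≡g+ch) ⟩
  g 0 + ∑ L (λ m → g (suc m) + c * h m)             ≡⟨ cong (_+_ (g 0)) (∑-+ L (g ∘ suc) (λ m → c * h m)) ⟩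
  g 0 + (∑ L (g ∘ suc) + ∑ L (λ m → c * h m))       ≡⟨ cong (λ s → g 0 + (∑ L (g ∘ suc) + s)) (∑-*ˡ L c h) ⟩
  g 0 + (∑ L (g ∘ suc) + c * ∑ L h)                 ≡⟨ +-assoc (g 0) _ _ ⟨
  g 0 + ∑ L (g ∘ suc) + c * ∑ L h                   ∎
  where open ≡-Reasoning

sum-upTo : ∀ n f → sum (map f (upTo n)) ≡ ∑ n f
sum-upTo n f = go n (λ i → i)
  where
  go : ∀ n g → sum (map f (applyUpTo g n)) ≡ ∑ n (f ∘ g)
  go zero    g = refl
  go (suc n) g = cong (_+_ (f (g 0))) (go n (g ∘ suc))

∑² : ℕ → ℕ → (ℕ → ℕ → ℚ) → ℚ
∑² M N f = ∑ M (λ m → ∑ N (f m))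

∑²-cong : ∀ M N {f g : ℕ → ℕ → ℚ} → (∀ m n → f m n ≡ g m n) → ∑² M N f ≡ ∑² M N g
∑²-cong M N f≗g = ∑-cong M (λ m → ∑-cong N (f≗g m))

∑²-truncate : ∀ {K M N} f → K ≤ M → K ≤ N → (∀ m n → K ≤ m ⊎ K ≤ n → f m n ≡ 0ℚ) → ∑² M N f ≡ ∑² K K f
∑²-truncate {K} {M} {N} f K≤M K≤N f≡0 = begin
  ∑ M (λ m → ∑ N (f m))   ≡⟨ ∑-truncate _ K≤M (λ m K≤m → ∑-zero N (f m) (λ n → f≡0 m n (inj₁ K≤m))) ⟩
  ∑ K (λ m → ∑ N (f m))   ≡⟨ ∑-cong K (λ m → ∑-truncate (f m) K≤N (λ n K≤n → f≡0 m n (inj₂ K≤n))) ⟩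
  ∑ K (λ m → ∑ K (f m))   ∎
  where open ≡-Reasoning

∑²-split-shiftᵐ : ∀ M N f g h c → (∀ n → f 0 n ≡ g 0 n) → (∀ m n → f (suc m) n ≡ g (suc m) n + c * h m n) →
                  ∑² (suc M) N f ≡ ∑² (suc M) N g + c * ∑² M N h
∑²-split-shiftᵐ M N f g h c f₀≡g₀ f≡g+ch =
  ∑-split-shift M (λ m → ∑ N (f m)) (λ m → ∑ N (g m)) (λ m → ∑ N (h m)) c (∑-cong N f₀≡g₀) (λ m → begin
    ∑ N (f (suc m))                                   ≡⟨ ∑-cong N (f≡g+ch m) ⟩
    ∑ N (λ n → g (suc m) n + c * h m n)               ≡⟨ ∑-+ N (g (suc m)) _ ⟩
    ∑ N (g (suc m)) + ∑ N (λ n → c * h m n)           ≡⟨ cong (_+_ (∑ N (g (suc m)))) (∑-*ˡ N c (h m)) ⟩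
    ∑ N (g (suc m)) + c * ∑ N (h m)                   ∎)
  where open ≡-Reasoning

∑²-split-shiftⁿ : ∀ M N f g h c → (∀ m → f m 0 ≡ g m 0) → (∀ m n → f m (suc n) ≡ g m (suc n) + c * h m n) →
                  ∑² M (suc N) f ≡ ∑² M (suc N) g + c * ∑² M N h
∑²-split-shiftⁿ M N f g h c f₀≡g₀ f≡g+ch = begin
  ∑ M (λ m → ∑ (suc N) (f m))
    ≡⟨ ∑-cong M (λ m → ∑-split-shift N (f m) (g m) (h m) c (f₀≡g₀ m) (f≡g+ch m)) ⟩
  ∑ M (λ m → ∑ (suc N) (g m) + c * ∑ N (h m))
    ≡⟨ ∑-+ M _ _ ⟩
  ∑ M (λ m → ∑ (suc N) (g m)) + ∑ M (λ m → c * ∑ N (h m))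
    ≡⟨ cong (_+_ (∑² M (suc N) g)) (∑-*ˡ M c _) ⟩
  ∑² M (suc N) g + c * ∑² M N h ∎
  where open ≡-Reasoning

C2-suc : ∀ k → suc k C 2 ≡ k C 2 ℕ.+ k
C2-suc k = begin
  suc k C 2             ≡⟨ nCk+nC[k+1]≡[n+1]C[k+1] k 1 ⟨
  k C 1 ℕ.+ k C 2       ≡⟨ cong (ℕ._+ k C 2) (nC1≡n k) ⟩
  k ℕ.+ k C 2           ≡⟨ ℕP.+-comm k _ ⟩
  k C 2 ℕ.+ k           ∎
  where open ≡-Reasoning

C2-step3 : ∀ n → (3 ℕ.* suc n ℕ.+ 1) C 2 ≡ (3 ℕ.* n ℕ.+ 1) C 2 ℕ.+ (9 ℕ.* n ℕ.+ 6)
C2-step3 n = begin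
  (3 ℕ.* suc n ℕ.+ 1) C 2                   ≡⟨ cong (_C 2) (three-more n) ⟩
  suc (suc (suc k)) C 2                     ≡⟨ C2-suc (suc (suc k)) ⟩
  suc (suc k) C 2 ℕ.+ suc (suc k)           ≡⟨ cong (ℕ._+ suc (suc k)) (C2-suc (suc k)) ⟩
  suc k C 2 ℕ.+ suc k ℕ.+ suc (suc k)       ≡⟨ cong (λ c → c ℕ.+ suc k ℕ.+ suc (suc k)) (C2-suc k) ⟩
  k C 2 ℕ.+ k ℕ.+ suc k ℕ.+ suc (suc k)     ≡⟨ collect (k C 2) n ⟩
  k C 2 ℕ.+ (9 ℕ.* n ℕ.+ 6)                 ∎
  where
  open ≡-Reasoning
  k : ℕ
  k = 3 ℕ.* n ℕ.+ 1
  three-more : ∀ n → 3 ℕ.* suc n ℕ.+ 1 ≡ suc (suc (suc (3 ℕ.* n ℕ.+ 1)))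
  three-more = ℕ-Solver.solve-∀
  collect : ∀ c n → c ℕ.+ (3 ℕ.* n ℕ.+ 1) ℕ.+ suc (3 ℕ.* n ℕ.+ 1) ℕ.+ suc (suc (3 ℕ.* n ℕ.+ 1)) ≡ c ℕ.+ (9 ℕ.* n ℕ.+ 6)
  collect = ℕ-Solver.solve-∀

-- The summands of F_N and of their Pascal splittings

module Expansion (q : ℚ) where

  ε : ℕ → ℕ → ℕ
  ε m n = ((3 ℕ.* n ℕ.+ 1) C 2) ℕ.+ m ℕ.* m ℕ.+ 3 ℕ.* m ℕ.* n

  weight : ℚ → ℕ → ℕ → ℕ → ℕ → ℚ
  weight x i j m n = (- 1ℚ) ^ n * q ^ (i ℕ.* m ℕ.+ j ℕ.* n ℕ.+ ε m n) * x ^ (m ℕ.+ 3 ℕ.* n)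

  binom₁ : ℤ → ℕ → ℕ → ℚ
  binom₁ A m n = qbinomℤ q (A ℤ.- (+ 3 ℤ.* + n ℤ.+ + m)) m

  binom₂ : ℤ → ℕ → ℕ → ℚ
  binom₂ B m n = qbinomℤ (q ^ 3) (B ℤ.- (+ 2 ℤ.* + n ℤ.+ + m)) n

  term : ℚ → ℤ → ℤ → ℕ → ℕ → ℕ → ℕ → ℚ
  term x A B i j m n = weight x i j m n * (binom₁ A m n * binom₂ B m n)

  weight-*-q^ : ∀ x i j i′ j′ m n k → i ℕ.* m ℕ.+ j ℕ.* n ℕ.+ ε m n ℕ.+ k ≡ i′ ℕ.* m ℕ.+ j′ ℕ.* n ℕ.+ ε m n →
                weight x i j m n * q ^ k ≡ weight x i′ j′ m n
  weight-*-q^ x i j i′ j′ m n k exponents = begin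
    s * q ^ e * y * q ^ k     ≡⟨ regroup s (q ^ e) y (q ^ k) ⟩
    s * (q ^ e * q ^ k) * y   ≡⟨ cong (λ r → s * r * y) (trans (sym (^-+ q e k)) (cong (q ^_) exponents)) ⟩
    s * q ^ e′ * y            ∎
    where
    open ≡-Reasoning
    s y : ℚ
    s = (- 1ℚ) ^ n
    y = x ^ (m ℕ.+ 3 ℕ.* n)
    e e′ : ℕ
    e = i ℕ.* m ℕ.+ j ℕ.* n ℕ.+ ε m n
    e′ = i′ ℕ.* m ℕ.+ j′ ℕ.* n ℕ.+ ε m n
    regroup : ∀ a b c d → a * b * c * d ≡ a * (b * d) * c
    regroup = solve-∀ ℚ-ring

  weight-x*q : ∀ x i j m n → weight (x * q) i j m n ≡ weight x (suc i) (3 ℕ.+ j) m n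
  weight-x*q x i j m n = begin
    s * q ^ e * (x * q) ^ k       ≡⟨ cong (s * q ^ e *_) (*-^ x q k) ⟩
    s * q ^ e * (x ^ k * q ^ k)   ≡⟨ *-assoc (s * q ^ e) (x ^ k) (q ^ k) ⟨
    s * q ^ e * x ^ k * q ^ k     ≡⟨ weight-*-q^ x i j (suc i) (3 ℕ.+ j) m n k (exponents i j m n (ε m n)) ⟩
    weight x (suc i) (3 ℕ.+ j) m n ∎
    where
    open ≡-Reasoning
    s : ℚ
    s = (- 1ℚ) ^ n
    e k : ℕ
    e = i ℕ.* m ℕ.+ j ℕ.* n ℕ.+ ε m n
    k = m ℕ.+ 3 ℕ.* n
    exponents : ∀ i j m n c → i ℕ.* m ℕ.+ j ℕ.* n ℕ.+ c ℕ.+ (m ℕ.+ 3 ℕ.* n) ≡ suc i ℕ.* m ℕ.+ (3 ℕ.+ j) ℕ.* n ℕ.+ c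
    exponents = ℕ-Solver.solve-∀

  weight-sucᵐ : ∀ x i j m n → weight x i j (suc m) n ≡ x * q ^ suc i * weight x (2 ℕ.+ i) (3 ℕ.+ j) m n
  weight-sucᵐ x i j m n = begin
    s * q ^ e * (x * y)                 ≡⟨ cong (λ t → s * q ^ t * (x * y)) (exponents i j m n ((3 ℕ.* n ℕ.+ 1) C 2)) ⟩
    s * q ^ (suc i ℕ.+ e′) * (x * y)    ≡⟨ cong (λ r → s * r * (x * y)) (^-+ q (suc i) e′) ⟩
    s * (q ^ suc i * q ^ e′) * (x * y)  ≡⟨ regroup s (q ^ suc i) (q ^ e′) x y ⟩
    x * q ^ suc i * (s * q ^ e′ * y)    ∎
    where
    open ≡-Reasoning
    s y : ℚ
    s = (- 1ℚ) ^ n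
    y = x ^ (m ℕ.+ 3 ℕ.* n)
    e e′ : ℕ
    e = i ℕ.* suc m ℕ.+ j ℕ.* n ℕ.+ ε (suc m) n
    e′ = (2 ℕ.+ i) ℕ.* m ℕ.+ (3 ℕ.+ j) ℕ.* n ℕ.+ ε m n
    exponents : ∀ i j m n c →
      i ℕ.* suc m ℕ.+ j ℕ.* n ℕ.+ (c ℕ.+ suc m ℕ.* suc m ℕ.+ 3 ℕ.* suc m ℕ.* n) ≡
      suc i ℕ.+ ((2 ℕ.+ i) ℕ.* m ℕ.+ (3 ℕ.+ j) ℕ.* n ℕ.+ (c ℕ.+ m ℕ.* m ℕ.+ 3 ℕ.* m ℕ.* n))
    exponents = ℕ-Solver.solve-∀
    regroup : ∀ s a b x y → s * (a * b) * (x * y) ≡ x * a * (s * b * y)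
    regroup = solve-∀ ℚ-ring

  weight-sucⁿ : ∀ x i j m n → weight x i j m (suc n) ≡ - (x ^ 3 * q ^ (6 ℕ.+ j)) * weight x (3 ℕ.+ i) (9 ℕ.+ j) m n
  weight-sucⁿ x i j m n = begin
    - 1ℚ * s * q ^ e * x ^ (m ℕ.+ 3 ℕ.* suc n)
      ≡⟨ cong₂ (λ t u → - 1ℚ * s * q ^ t * x ^ u) q-exponent (x-exponent m n) ⟩
    - 1ℚ * s * q ^ (6 ℕ.+ j ℕ.+ e′) * x ^ (3 ℕ.+ k)
      ≡⟨ cong₂ (λ r t → - 1ℚ * s * r * t) (^-+ q (6 ℕ.+ j) e′) (^-+ x 3 k) ⟩
    - 1ℚ * s * (q ^ (6 ℕ.+ j) * q ^ e′) * (x ^ 3 * x ^ k)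
      ≡⟨ regroup s (q ^ (6 ℕ.+ j)) (q ^ e′) (x ^ 3) (x ^ k) ⟩
    - (x ^ 3 * q ^ (6 ℕ.+ j)) * (s * q ^ e′ * x ^ k) ∎
    where
    open ≡-Reasoning
    s : ℚ
    s = (- 1ℚ) ^ n
    e e′ k : ℕ
    e = i ℕ.* m ℕ.+ j ℕ.* suc n ℕ.+ ε m (suc n)
    e′ = (3 ℕ.+ i) ℕ.* m ℕ.+ (9 ℕ.+ j) ℕ.* n ℕ.+ ε m n
    k = m ℕ.+ 3 ℕ.* n
    exponents : ∀ i j m n c →
      i ℕ.* m ℕ.+ j ℕ.* suc n ℕ.+ (c ℕ.+ (9 ℕ.* n ℕ.+ 6) ℕ.+ m ℕ.* m ℕ.+ 3 ℕ.* m ℕ.* suc n) ≡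
      6 ℕ.+ j ℕ.+ ((3 ℕ.+ i) ℕ.* m ℕ.+ (9 ℕ.+ j) ℕ.* n ℕ.+ (c ℕ.+ m ℕ.* m ℕ.+ 3 ℕ.* m ℕ.* n))
    exponents = ℕ-Solver.solve-∀
    q-exponent : e ≡ 6 ℕ.+ j ℕ.+ e′
    q-exponent = trans (cong (λ c → i ℕ.* m ℕ.+ j ℕ.* suc n ℕ.+ (c ℕ.+ m ℕ.* m ℕ.+ 3 ℕ.* m ℕ.* suc n)) (C2-step3 n))
                       (exponents i j m n ((3 ℕ.* n ℕ.+ 1) C 2))
    x-exponent : ∀ m n → m ℕ.+ 3 ℕ.* suc n ≡ 3 ℕ.+ (m ℕ.+ 3 ℕ.* n)
    x-exponent = ℕ-Solver.solve-∀
    regroup : ∀ s a b c d → - 1ℚ * s * (a * b) * (c * d) ≡ - (c * a) * (s * b * d)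
    regroup = solve-∀ ℚ-ring

  weight-sucᵐ-*-q^ : ∀ x i j m n → weight x i j (suc m) n * q ^ suc m ≡ weight x (suc i) j (suc m) n
  weight-sucᵐ-*-q^ x i j m n = weight-*-q^ x i j (suc i) j (suc m) n (suc m) (exponents i j m n (ε (suc m) n))
    where
    exponents : ∀ i j m n e → i ℕ.* suc m ℕ.+ j ℕ.* n ℕ.+ e ℕ.+ suc m ≡ suc i ℕ.* suc m ℕ.+ j ℕ.* n ℕ.+ e
    exponents = ℕ-Solver.solve-∀

  weight-sucⁿ-*-q³^ : ∀ x i j m n → weight x i j m (suc n) * (q ^ 3) ^ suc n ≡ weight x i (3 ℕ.+ j) m (suc n)
  weight-sucⁿ-*-q³^ x i j m n = trans (cong (weight x i j m (suc n) *_) (sym (^-* q 3 (suc n))))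
    (weight-*-q^ x i j i (3 ℕ.+ j) m (suc n) (3 ℕ.* suc n) (exponents i j m n (ε m (suc n))))
    where
    exponents : ∀ i j m n e → i ℕ.* m ℕ.+ j ℕ.* suc n ℕ.+ e ℕ.+ 3 ℕ.* suc n ≡ i ℕ.* m ℕ.+ (3 ℕ.+ j) ℕ.* suc n ℕ.+ e
    exponents = ℕ-Solver.solve-∀

  binom₁-pascal : ∀ A m n → binom₁ (ℤ.suc A) (suc m) n ≡ binom₁ (ℤ.pred A) m n + q ^ suc m * binom₁ A (suc m) n
  binom₁-pascal A m n = begin
    qbinomℤ q (ℤ.suc A ℤ.- (k ℤ.+ + suc m)) (suc m)
      ≡⟨ cong (λ V → qbinomℤ q V (suc m)) (top-suc A (k ℤ.+ + suc m)) ⟩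
    qbinomℤ q (ℤ.suc (A ℤ.- (k ℤ.+ + suc m))) (suc m)
      ≡⟨ cong (λ V → qbinomℤ q (ℤ.suc V) (suc m)) (top-sucᵐ A k (+ m)) ⟩
    qbinomℤ q (ℤ.suc (ℤ.pred A ℤ.- (k ℤ.+ + m))) (suc m)
      ≡⟨ qbinomℤ-pascal q (ℤ.pred A ℤ.- (k ℤ.+ + m)) m ⟩
    binom₁ (ℤ.pred A) m n + q ^ suc m * qbinomℤ q (ℤ.pred A ℤ.- (k ℤ.+ + m)) (suc m)
      ≡⟨ cong (λ V → binom₁ (ℤ.pred A) m n + q ^ suc m * qbinomℤ q V (suc m)) (top-sucᵐ A k (+ m)) ⟨
    binom₁ (ℤ.pred A) m n + q ^ suc m * binom₁ A (suc m) n ∎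
    where
    open ≡-Reasoning
    k : ℤ
    k = + 3 ℤ.* + n

  binom₂-sucᵐ : ∀ A m n → binom₂ A (suc m) n ≡ binom₂ (ℤ.pred A) m n
  binom₂-sucᵐ A m n = cong (λ V → qbinomℤ (q ^ 3) V n) (top-sucᵐ A (+ 2 ℤ.* + n) (+ m))

  binom₁-sucⁿ : ∀ A m n → binom₁ (ℤ.suc A) m (suc n) ≡ binom₁ (ℤ.pred (ℤ.pred A)) m n
  binom₁-sucⁿ A m n = cong (λ V → qbinomℤ q V m) (top-sucⁿ₁ A (+ n) (+ m))

  binom₂-pascal : ∀ A m n →
    binom₂ (ℤ.suc A) m (suc n) ≡ binom₂ (ℤ.pred (ℤ.pred A)) m n + (q ^ 3) ^ suc n * binom₂ A m (suc n)
  binom₂-pascal A m n = begin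
    qbinomℤ (q ^ 3) (ℤ.suc A ℤ.- k) (suc n)
      ≡⟨ cong (λ V → qbinomℤ (q ^ 3) V (suc n)) (top-suc A k) ⟩
    qbinomℤ (q ^ 3) (ℤ.suc (A ℤ.- k)) (suc n)
      ≡⟨ qbinomℤ-pascal (q ^ 3) (A ℤ.- k) n ⟩
    qbinomℤ (q ^ 3) (A ℤ.- k) n + (q ^ 3) ^ suc n * binom₂ A m (suc n)
      ≡⟨ cong (λ V → qbinomℤ (q ^ 3) V n + (q ^ 3) ^ suc n * binom₂ A m (suc n)) (top-sucⁿ₂ A (+ n) (+ m)) ⟩
    binom₂ (ℤ.pred (ℤ.pred A)) m n + (q ^ 3) ^ suc n * binom₂ A m (suc n) ∎
    where
    open ≡-Reasoning
    k : ℤ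
    k = + 2 ℤ.* + suc n ℤ.+ + m

  -- At m = 0 the two first binomials differ only if A - 3n = -1, and then the second one is [n - 1, n] = 0.
  term-pascalᵐ-zero : ∀ x A i j n → term x (ℤ.suc A) A i j 0 n ≡ term x A A (suc i) j 0 n
  term-pascalᵐ-zero x A i j n = cong (weight x i j 0 n *_) (begin
    qbinomℤ q (ℤ.suc A ℤ.- k) 0 * binom₂ A 0 n   ≡⟨ cong (λ V → qbinomℤ q V 0 * binom₂ A 0 n) (top-suc A k) ⟩
    qbinomℤ q (ℤ.suc U) 0 * binom₂ A 0 n         ≡⟨ qbinomℤ-suc-zero q U (binom₂ A 0 n) binom₂≡0 ⟩
    qbinomℤ q U 0 * binom₂ A 0 n                 ∎)
    where
    open ≡-Reasoning
    k U : ℤ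
    k = + 3 ℤ.* + n ℤ.+ + 0
    U = A ℤ.- k
    binom₂≡0 : U ≡ -[1+ 0 ] → binom₂ A 0 n ≡ 0ℚ
    binom₂≡0 U≡-1 = trans (cong (λ V → qbinomℤ (q ^ 3) V n) (trans (top₂-top₁ A (+ n) (+ 0)) (cong (ℤ._+ + n) U≡-1)))
                          (qbinomℤ-pred-diag (q ^ 3) n)

  term-pascalᵐ-suc : ∀ x A i j m n →
    term x (ℤ.suc A) A i j (suc m) n ≡
    term x A A (suc i) j (suc m) n + x * q ^ suc i * term x (ℤ.pred A) (ℤ.pred A) (2 ℕ.+ i) (3 ℕ.+ j) m n
  term-pascalᵐ-suc x A i j m n = begin
    w * (binom₁ (ℤ.suc A) (suc m) n * b)
      ≡⟨ cong (λ g → w * (g * b)) (binom₁-pascal A m n) ⟩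
    w * ((f′ + q ^ suc m * f) * b)
      ≡⟨ distribute w f′ (q ^ suc m) f b ⟩
    w * q ^ suc m * (f * b) + w * (f′ * b)
      ≡⟨ cong₂ (λ u v → u * (f * b) + v * (f′ * b)) (weight-sucᵐ-*-q^ x i j m n) (weight-sucᵐ x i j m n) ⟩
    weight x (suc i) j (suc m) n * (f * b) + c * w′ * (f′ * b)
      ≡⟨ cong (λ v → weight x (suc i) j (suc m) n * (f * b) + c * w′ * (f′ * v)) (binom₂-sucᵐ A m n) ⟩
    weight x (suc i) j (suc m) n * (f * b) + c * w′ * (f′ * binom₂ (ℤ.pred A) m n)
      ≡⟨ cong (_+_ (weight x (suc i) j (suc m) n * (f * b))) (*-assoc c w′ _) ⟩
    term x A A (suc i) j (suc m) n + c * term x (ℤ.pred A) (ℤ.pred A) (2 ℕ.+ i) (3 ℕ.+ j) m n ∎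
    where
    open ≡-Reasoning
    w w′ c f f′ b : ℚ
    w = weight x i j (suc m) n
    w′ = weight x (2 ℕ.+ i) (3 ℕ.+ j) m n
    c = x * q ^ suc i
    f = binom₁ A (suc m) n
    f′ = binom₁ (ℤ.pred A) m n
    b = binom₂ A (suc m) n
    distribute : ∀ w a u c b → w * ((a + u * c) * b) ≡ w * u * (c * b) + w * (a * b)
    distribute = solve-∀ ℚ-ring

  -- At n = 0 the two second binomials differ only if m = a + 1, and then the first one is [0, a + 1] = 0.
  term-pascalⁿ-zero : ∀ x a i j m → term x (+ suc a) (+ suc a) i j m 0 ≡ term x (+ suc a) (+ a) i (3 ℕ.+ j) m 0
  term-pascalⁿ-zero x a i j m = cong (weight x i j m 0 *_) (begin
    f * qbinomℤ (q ^ 3) (+ suc a ℤ.- k) 0      ≡⟨ cong (λ V → f * qbinomℤ (q ^ 3) V 0) (top-suc (+ a) k) ⟩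
    f * qbinomℤ (q ^ 3) (ℤ.suc U) 0            ≡⟨ *-comm f _ ⟩
    qbinomℤ (q ^ 3) (ℤ.suc U) 0 * f            ≡⟨ qbinomℤ-suc-zero (q ^ 3) U f (binom₁≡0 m) ⟩
    qbinomℤ (q ^ 3) U 0 * f                    ≡⟨ *-comm _ f ⟩
    f * qbinomℤ (q ^ 3) U 0                    ∎)
    where
    open ≡-Reasoning
    f : ℚ
    f = binom₁ (+ suc a) m 0
    k U : ℤ
    k = + 2 ℤ.* + 0 ℤ.+ + m
    U = + a ℤ.- k
    binom₁≡0 : ∀ m → + a ℤ.- (+ 2 ℤ.* + 0 ℤ.+ + m) ≡ -[1+ 0 ] → binom₁ (+ suc a) m 0 ≡ 0ℚ
    binom₁≡0 zero    ()
    binom₁≡0 (suc m) U≡-1 = trans (cong (λ V → qbinomℤ q V (suc m)) (top-suc (+ a) (+ 2 ℤ.* + 0 ℤ.+ + suc m)))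
                                  (cong (λ V → qbinomℤ q (ℤ.suc V) (suc m)) U≡-1)

  term-pascalⁿ-suc : ∀ x A i j m n →
    term x (ℤ.suc A) (ℤ.suc A) i j m (suc n) ≡
    term x (ℤ.suc A) A i (3 ℕ.+ j) m (suc n) +
    - (x ^ 3 * q ^ (6 ℕ.+ j)) * term x (ℤ.pred (ℤ.pred A)) (ℤ.pred (ℤ.pred A)) (3 ℕ.+ i) (9 ℕ.+ j) m n
  term-pascalⁿ-suc x A i j m n = begin
    w * (f * binom₂ (ℤ.suc A) m (suc n))
      ≡⟨ cong (λ g → w * (f * g)) (binom₂-pascal A m n) ⟩
    w * (f * (b′ + (q ^ 3) ^ suc n * b))
      ≡⟨ distribute w f b′ ((q ^ 3) ^ suc n) b ⟩
    w * (q ^ 3) ^ suc n * (f * b) + w * (f * b′)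
      ≡⟨ cong₂ (λ u v → u * (f * b) + v) (weight-sucⁿ-*-q³^ x i j m n)
               (cong₂ (λ v g → v * (g * b′)) (weight-sucⁿ x i j m n) (binom₁-sucⁿ A m n)) ⟩
    weight x i (3 ℕ.+ j) m (suc n) * (f * b) + c * w′ * (binom₁ A″ m n * b′)
      ≡⟨ cong (_+_ (weight x i (3 ℕ.+ j) m (suc n) * (f * b))) (*-assoc c w′ _) ⟩
    term x (ℤ.suc A) A i (3 ℕ.+ j) m (suc n) + c * term x A″ A″ (3 ℕ.+ i) (9 ℕ.+ j) m n ∎
    where
    open ≡-Reasoning
    A″ : ℤ
    A″ = ℤ.pred (ℤ.pred A)
    w w′ c f b b′ : ℚ
    w = weight x i j m (suc n)
    w′ = weight x (3 ℕ.+ i) (9 ℕ.+ j) m n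
    c = - (x ^ 3 * q ^ (6 ℕ.+ j))
    f = binom₁ (ℤ.suc A) m (suc n)
    b = binom₂ A m (suc n)
    b′ = binom₂ A″ m n
    distribute : ∀ w f a u b → w * (f * (a + u * b)) ≡ w * u * (f * b) + w * (f * a)
    distribute = solve-∀ ℚ-ring

  term-outside-box : ∀ x A B i j m n → box A ≤ m ⊎ box A ≤ n → term x A B i j m n ≡ 0ℚ
  term-outside-box x A B i j m n outside = begin
    weight x i j m n * (binom₁ A m n * binom₂ B m n)   ≡⟨ cong (λ f → weight x i j m n * (f * binom₂ B m n)) binom₁≡0 ⟩
    weight x i j m n * (0ℚ * binom₂ B m n)             ≡⟨ cong (weight x i j m n *_) (*-zeroˡ (binom₂ B m n)) ⟩
    weight x i j m n * 0ℚ                              ≡⟨ *-zeroʳ (weight x i j m n) ⟩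
    0ℚ                                                 ∎
    where
    open ≡-Reasoning
    box≤ : box A ≤ m ⊎ box A ≤ n → box A ≤ 3 ℕ.* n ℕ.+ m
    box≤ (inj₁ box≤m) = ℕP.≤-trans box≤m (ℕP.m≤n+m m (3 ℕ.* n))
    box≤ (inj₂ box≤n) = ℕP.≤-trans box≤n (ℕP.≤-trans (ℕP.m≤n*m n 3) (ℕP.m≤m+n (3 ℕ.* n) m))
    binom₁≡0 : binom₁ A m n ≡ 0ℚ
    binom₁≡0 = trans (cong (λ V → qbinomℤ q V m) (top-ℕ A 3 n m)) (qbinomℤ-outside-box q A (3 ℕ.* n ℕ.+ m) m (box≤ outside))

  -- Φ x A B i j = Σ_{m,n ≥ 0} term x A B i j m n; the terms vanish outside the box [0, box A)².
  Φ : ℚ → ℤ → ℤ → ℕ → ℕ → ℚ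
  Φ x A B i j = ∑² (box A) (box A) (term x A B i j)

  Φ-box : ∀ {M N} x A B i j → box A ≤ M → box A ≤ N → ∑² M N (term x A B i j) ≡ Φ x A B i j
  Φ-box x A B i j box≤M box≤N = ∑²-truncate (term x A B i j) box≤M box≤N (term-outside-box x A B i j)

  Φ-x*q : ∀ x A B i j → Φ (x * q) A B i j ≡ Φ x A B (suc i) (3 ℕ.+ j)
  Φ-x*q x A B i j = ∑²-cong (box A) (box A) (λ m n → cong (_* (binom₁ A m n * binom₂ B m n)) (weight-x*q x i j m n))

  Φ-pascalᵐ : ∀ x A i j →
    Φ x (ℤ.suc A) A i j ≡ Φ x A A (suc i) j + x * q ^ suc i * Φ x (ℤ.pred A) (ℤ.pred A) (2 ℕ.+ i) (3 ℕ.+ j)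
  Φ-pascalᵐ x A i j = begin
    Φ x (ℤ.suc A) A i j
      ≡⟨ Φ-box x (ℤ.suc A) A i j (ℕP.n≤1+n L) ℕP.≤-refl ⟨
    ∑² (suc L) L (term x (ℤ.suc A) A i j)
      ≡⟨ ∑²-split-shiftᵐ L L (term x (ℤ.suc A) A i j) (term x A A (suc i) j) (term x A′ A′ (2 ℕ.+ i) (3 ℕ.+ j)) c
           (term-pascalᵐ-zero x A i j) (term-pascalᵐ-suc x A i j) ⟩
    ∑² (suc L) L (term x A A (suc i) j) + c * ∑² L L (term x A′ A′ (2 ℕ.+ i) (3 ℕ.+ j))
      ≡⟨ cong₂ (λ u v → u + c * v) (Φ-box x A A (suc i) j (ℕP.m≤n⇒m≤1+n (box-suc A)) (box-suc A))
                                   (Φ-box x A′ A′ (2 ℕ.+ i) (3 ℕ.+ j) box-A′ box-A′) ⟩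
    Φ x A A (suc i) j + c * Φ x A′ A′ (2 ℕ.+ i) (3 ℕ.+ j) ∎
    where
    open ≡-Reasoning
    L : ℕ
    L = box (ℤ.suc A)
    A′ : ℤ
    A′ = ℤ.pred A
    c : ℚ
    c = x * q ^ suc i
    box-A′ : box A′ ≤ L
    box-A′ = ℕP.≤-trans (box-pred A) (box-suc A)

  Φ-pascalⁿ : ∀ x a i j →
    Φ x (+ suc a) (+ suc a) i j ≡
    Φ x (+ suc a) (+ a) i (3 ℕ.+ j) +
    - (x ^ 3 * q ^ (6 ℕ.+ j)) * Φ x (ℤ.pred (ℤ.pred (+ a))) (ℤ.pred (ℤ.pred (+ a))) (3 ℕ.+ i) (9 ℕ.+ j)
  Φ-pascalⁿ x a i j = begin
    Φ x (+ suc a) (+ suc a) i j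
      ≡⟨ ∑²-split-shiftⁿ L (suc a) (term x (+ suc a) (+ suc a) i j) (term x (+ suc a) (+ a) i (3 ℕ.+ j))
           (term x A″ A″ (3 ℕ.+ i) (9 ℕ.+ j)) c
           (term-pascalⁿ-zero x a i j) (term-pascalⁿ-suc x (+ a) i j) ⟩
    Φ x (+ suc a) (+ a) i (3 ℕ.+ j) + c * ∑² L (suc a) (term x A″ A″ (3 ℕ.+ i) (9 ℕ.+ j))
      ≡⟨ cong (λ v → Φ x (+ suc a) (+ a) i (3 ℕ.+ j) + c * v)
              (Φ-box x A″ A″ (3 ℕ.+ i) (9 ℕ.+ j) (ℕP.m≤n⇒m≤1+n box-A″) box-A″) ⟩
    Φ x (+ suc a) (+ a) i (3 ℕ.+ j) + c * Φ x A″ A″ (3 ℕ.+ i) (9 ℕ.+ j) ∎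
    where
    open ≡-Reasoning
    L : ℕ
    L = suc (suc a)
    A″ : ℤ
    A″ = ℤ.pred (ℤ.pred (+ a))
    c : ℚ
    c = - (x ^ 3 * q ^ (6 ℕ.+ j))
    box-A″ : box A″ ≤ suc a
    box-A″ = ℕP.≤-trans (box-pred (ℤ.pred (+ a))) (box-pred (+ a))

  -- F_A(x) for every integer A (zero for A < 0).
  Fℤ : ℤ → ℚ → ℚ
  Fℤ A x = Φ x (ℤ.suc A) A 0 0

  -- A single term, whose q³-binomial is [-1, 0] = 0.
  Fℤ-minus-one : ∀ x → Fℤ -[1+ 0 ] x ≡ 0ℚ
  Fℤ-minus-one x = refl

  Fℤ-recurrence : ∀ n x → Fℤ (+ suc n) x ≡ (1ℚ + x * q) * Fℤ (+ n) (x * q) - x ^ 2 * q ^ 3 * Fℤ (ℤ.pred (+ n)) (x * q * q)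
  Fℤ-recurrence n x = begin
    Fℤ (+ suc n) x
      ≡⟨ Φ-pascalᵐ x (+ suc n) 0 0 ⟩
    Φ x (+ suc n) (+ suc n) 1 0 + x * q ^ 1 * Φ₂₃
      ≡⟨ cong (_+ x * q ^ 1 * Φ₂₃) (Φ-pascalⁿ x n 1 0) ⟩
    Φ x (+ suc n) (+ n) 1 3 + - (x ^ 3 * q ^ 6) * Φ₄₉ + x * q ^ 1 * Φ₂₃
      ≡⟨ cong (λ a → a + - (x ^ 3 * q ^ 6) * Φ₄₉ + x * q ^ 1 * Φ₂₃) (Φ-pascalᵐ x (+ n) 1 3) ⟩
    Φ₂₃ + x * q ^ 2 * Φ₃₆ + - (x ^ 3 * q ^ 6) * Φ₄₉ + x * q ^ 1 * Φ₂₃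
      ≡⟨ rearrange x q Φ₂₃ Φ₃₆ Φ₄₉ ⟩
    (1ℚ + x * q) * (Φ₂₃ + x * q ^ 2 * Φ₃₆) - x ^ 2 * q ^ 3 * (Φ₃₆ + x * q ^ 3 * Φ₄₉)
      ≡⟨ cong₂ (λ u v → (1ℚ + x * q) * u - x ^ 2 * q ^ 3 * v) Fℤ-x*q Fℤ-x*q*q ⟨
    (1ℚ + x * q) * Fℤ (+ n) (x * q) - x ^ 2 * q ^ 3 * Fℤ P (x * q * q) ∎
    where
    open ≡-Reasoning
    P : ℤ
    P = ℤ.pred (+ n)
    Φ₂₃ Φ₃₆ Φ₄₉ : ℚ
    Φ₂₃ = Φ x (+ n) (+ n) 2 3
    Φ₃₆ = Φ x P P 3 6
    Φ₄₉ = Φ x (ℤ.pred P) (ℤ.pred P) 4 9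
    Fℤ-x*q : Fℤ (+ n) (x * q) ≡ Φ₂₃ + x * q ^ 2 * Φ₃₆
    Fℤ-x*q = trans (Φ-x*q x (+ suc n) (+ n) 0 0) (Φ-pascalᵐ x (+ n) 1 3)
    Fℤ-x*q*q : Fℤ P (x * q * q) ≡ Φ₃₆ + x * q ^ 3 * Φ₄₉
    Fℤ-x*q*q = trans (Φ-x*q (x * q) (ℤ.suc P) P 0 0) (trans (Φ-x*q x (ℤ.suc P) P 1 3) (Φ-pascalᵐ x P 2 6))
    -- The powers are unfolded so that the ring solver sees products instead of opaque _^_.
    rearrange : ∀ x q a b c →
      a + x * (q * (q * 1ℚ)) * b + - (x * (x * (x * 1ℚ)) * (q * (q * (q * (q * (q * (q * 1ℚ))))))) * c + x * (q * 1ℚ) * a ≡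
      (1ℚ + x * q) * (a + x * (q * (q * 1ℚ)) * b) - x * (x * 1ℚ) * (q * (q * (q * 1ℚ))) * (b + x * (q * (q * (q * 1ℚ))) * c)
    rearrange = solve-∀ ℚ-ring

  -- Φ x (+ 0) (+ 0) 1 0 is the single term 1 and Φ x -[1+ 0 ] -[1+ 0 ] 2 3 is an empty sum, both by computation.
  Fℤ-zero : ∀ x → Fℤ (+ 0) x ≡ 1ℚ
  Fℤ-zero x = trans (Φ-pascalᵐ x (+ 0) 0 0) (vanish x (q ^ 1))
    where
    vanish : ∀ x r → 1ℚ + x * r * 0ℚ ≡ 1ℚ
    vanish = solve-∀ ℚ-ring

  Fℤ-one : ∀ x → Fℤ (+ 1) x ≡ 1ℚ + x * q
  Fℤ-one x = begin
    Fℤ (+ 1) x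
      ≡⟨ Fℤ-recurrence 0 x ⟩
    (1ℚ + x * q) * Fℤ (+ 0) (x * q) - x ^ 2 * q ^ 3 * Fℤ -[1+ 0 ] (x * q * q)
      ≡⟨ cong₂ (λ u v → (1ℚ + x * q) * u - x ^ 2 * q ^ 3 * v) (Fℤ-zero (x * q)) (Fℤ-minus-one (x * q * q)) ⟩
    (1ℚ + x * q) * 1ℚ - x ^ 2 * q ^ 3 * 0ℚ
      ≡⟨ simplify (x * q) (x ^ 2 * q ^ 3) ⟩
    1ℚ + x * q ∎
    where
    open ≡-Reasoning
    simplify : ∀ a b → (1ℚ + a) * 1ℚ - b * 0ℚ ≡ 1ℚ + a
    simplify = solve-∀ ℚ-ring

  module _ (q≢root : ∀ k → q ^ suc k ≢ 1ℚ) where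

    q³≢root : ∀ k → (q ^ 3) ^ suc k ≢ 1ℚ
    q³≢root k q³ᵏ≡1 = q≢root (k ℕ.+ 2 ℕ.* suc k) (trans (^-* q 3 (suc k)) q³ᵏ≡1)

    Fterm≡term : ∀ N x m n → Fterm N q x m n ≡ term x (+ suc N) (+ N) 0 0 m n
    Fterm≡term N x m n = trans (*-assoc (weight x 0 0 m n) _ _) (cong (weight x 0 0 m n *_) (cong₂ _*_
      (trans (gbin-qbinomℤ q q≢root (+ N ℤ.- + (3 ℕ.* n) ℤ.- + m ℤ.+ + 1) m) (cong (λ V → qbinomℤ q V m)
        (trans (top-Fterm₁ (+ N) (+ (3 ℕ.* n)) (+ m)) (cong (λ t → + suc N ℤ.- (t ℤ.+ + m)) (ℤP.pos-* 3 n)))))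
      (trans (gbin-qbinomℤ (q ^ 3) q³≢root (+ N ℤ.- + (2 ℕ.* n) ℤ.- + m) n) (cong (λ V → qbinomℤ (q ^ 3) V n)
        (trans (top-Fterm₂ (+ N) (+ (2 ℕ.* n)) (+ m)) (cong (λ t → + N ℤ.- (t ℤ.+ + m)) (ℤP.pos-* 2 n)))))))

    F≡Fℤ : ∀ N x → F N q x ≡ Fℤ (+ N) x
    F≡Fℤ N x = begin
      sum (map (λ m → sum (map (λ n → Fterm N q x m n) (upTo L))) (upTo L))
        ≡⟨ sum-upTo L (λ m → sum (map (λ n → Fterm N q x m n) (upTo L))) ⟩
      ∑ L (λ m → sum (map (λ n → Fterm N q x m n) (upTo L)))
        ≡⟨ ∑-cong L (λ m → sum-upTo L (Fterm N q x m)) ⟩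
      ∑² L L (Fterm N q x)
        ≡⟨ ∑²-cong L L (Fterm≡term N x) ⟩
      Fℤ (+ N) x ∎
      where
      open ≡-Reasoning
      L : ℕ
      L = suc (suc N)

-- Continued fractions of three-term recurrences

continued-fraction-step : ∀ a b D E → D ≢ 0ℚ → E ≢ 0ℚ → (a * D - b * E) /' D ≡ a - b /' (D /' E)
continued-fraction-step a b D E D≢0 E≢0 = /'-unique _ D _ D≢0 (sym (begin
  (a - b /' r) * D               ≡⟨ cong ((a - b /' r) *_) rE≡D ⟨
  (a - b /' r) * (r * E)         ≡⟨ expand a (b /' r) r E ⟩
  a * (r * E) - b /' r * r * E   ≡⟨ cong₂ (λ u v → a * u - v * E) rE≡D (/'-*-cancel b r r≢0) ⟩
  a * D - b * E                  ∎))
  where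
  open ≡-Reasoning
  r : ℚ
  r = D /' E
  rE≡D : r * E ≡ D
  rE≡D = /'-*-cancel D E E≢0
  r≢0 : r ≢ 0ℚ
  r≢0 r≡0 = D≢0 (trans (sym rE≡D) (trans (cong (_* E) r≡0) (*-zeroˡ E)))
  expand : ∀ a u r E → (a - u) * (r * E) ≡ a * (r * E) - u * r * E
  expand = solve-∀ ℚ-ring

module ThreeTermRecurrence
  (a b : ℕ → ℚ) (f c : ℕ → ℕ → ℚ)
  (f-zero : ∀ s → f 0 s ≡ 1ℚ)
  (f-one  : ∀ s → f 1 s ≡ a (suc s))
  (f-rec  : ∀ k s → f (suc (suc k)) s ≡ a (suc s) * f (suc k) (suc s) - b (suc s) * f k (suc (suc s)))
  (c-zero : ∀ r → c r 0 ≡ a r)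
  (c-suc  : ∀ r k → c r (suc k) ≡ a r - b r /' c (suc r) k)
  where

  -- The tails of the continued fraction c (suc s) k are the c r l with r + l = suc s + k and r ≥ s + 2.
  TailsNonzero : ℕ → ℕ → Set
  TailsNonzero s k = ∀ r l → suc (suc s) ≤ r → r ℕ.+ l ≡ suc s ℕ.+ k → c r l ≢ 0ℚ

  tails-shift : ∀ {s k} → TailsNonzero s (suc k) → TailsNonzero (suc s) k
  tails-shift {s} {k} tails r l s+3≤r r+l≡ = tails r l (ℕP.<⇒≤ s+3≤r) (trans r+l≡ (sym (ℕP.+-suc (suc s) k)))

  tails-head : ∀ {s k} → TailsNonzero s (suc k) → c (suc (suc s)) k ≢ 0ℚ
  tails-head {s} {k} tails = tails (suc (suc s)) k ℕP.≤-refl (sym (ℕP.+-suc (suc s) k))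

  denominator-≢0 : ∀ k s → TailsNonzero s (suc k) → f (suc k) (suc s) ≢ 0ℚ → f k (suc (suc s)) ≢ 0ℚ

  ratio-continued-fraction : ∀ k s → TailsNonzero s k → f k (suc s) ≢ 0ℚ → f (suc k) s /' f k (suc s) ≡ c (suc s) k
  ratio-continued-fraction zero s _ _ = begin
    f 1 s /' f 0 (suc s)    ≡⟨ cong₂ _/'_ (f-one s) (f-zero (suc s)) ⟩
    a (suc s) /' 1ℚ         ≡⟨ /'-unique _ 1ℚ _ 1≢0 (sym (*-identityʳ (a (suc s)))) ⟩
    a (suc s)               ≡⟨ c-zero (suc s) ⟨
    c (suc s) 0             ∎
    where open ≡-Reasoning
  ratio-continued-fraction (suc k) s tails D≢0 = begin
    f (suc (suc k)) s /' D                       ≡⟨ cong (_/' D) (f-rec k s) ⟩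
    (a (suc s) * D - b (suc s) * E) /' D         ≡⟨ continued-fraction-step (a (suc s)) (b (suc s)) D E D≢0 E≢0 ⟩
    a (suc s) - b (suc s) /' (D /' E)            ≡⟨ cong (λ r → a (suc s) - b (suc s) /' r) IH ⟩
    a (suc s) - b (suc s) /' c (suc (suc s)) k   ≡⟨ c-suc (suc s) k ⟨
    c (suc s) (suc k)                            ∎
    where
    open ≡-Reasoning
    D E : ℚ
    D = f (suc k) (suc s)
    E = f k (suc (suc s))
    E≢0 : E ≢ 0ℚ
    E≢0 = denominator-≢0 k s tails D≢0
    IH : D /' E ≡ c (suc (suc s)) k
    IH = ratio-continued-fraction k (suc s) (tails-shift tails) E≢0

  -- If the denominator E vanished, then either the next one G vanishes too and the recurrence kills the
  -- numerator D, or the ratio E / G = 0 is a tail of the continued fraction.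
  denominator-≢0 zero    s _     _   E≡0 = 1≢0 (trans (sym (f-zero (suc (suc s)))) E≡0)
  denominator-≢0 (suc k) s tails D≢0 E≡0 with f k (suc (suc (suc s))) ≟ 0ℚ
  ... | yes G≡0 = D≢0 (begin
    f (suc (suc k)) (suc s)                                                       ≡⟨ f-rec k (suc s) ⟩
    a (suc (suc s)) * f (suc k) (suc (suc s)) - b (suc (suc s)) * f k (suc (suc (suc s)))
      ≡⟨ cong₂ (λ u v → a (suc (suc s)) * u - b (suc (suc s)) * v) E≡0 G≡0 ⟩
    a (suc (suc s)) * 0ℚ - b (suc (suc s)) * 0ℚ                                   ≡⟨ vanish (a (suc (suc s))) (b (suc (suc s))) ⟩
    0ℚ                                                                            ∎)
    where
    open ≡-Reasoning
    vanish : ∀ u v → u * 0ℚ - v * 0ℚ ≡ 0ℚ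
    vanish = solve-∀ ℚ-ring
  ... | no G≢0 = tails-head (tails-shift tails) (begin
    c (suc (suc (suc s))) k                                  ≡⟨ ratio-continued-fraction k (suc (suc s)) (tails-shift (tails-shift tails)) G≢0 ⟨
    f (suc k) (suc (suc s)) /' f k (suc (suc (suc s)))       ≡⟨ cong (_/' f k (suc (suc (suc s)))) E≡0 ⟩
    0ℚ /' f k (suc (suc (suc s)))                            ≡⟨ 0/' (f k (suc (suc (suc s)))) ⟩
    0ℚ                                                       ∎)
    where open ≡-Reasoning

module Shifted (x q : ℚ) where

  open Expansion q

  f : ℕ → ℕ → ℚ
  f k s = Fℤ (+ k) (x * q ^ s)

  x-shift : ∀ s → x * q ^ s * q ≡ x * q ^ suc s
  x-shift s = shift x q (q ^ s)
    where
    shift : ∀ x q t → x * t * q ≡ x * (q * t)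
    shift = solve-∀ ℚ-ring

  coefficient : ∀ s → (x * q ^ s) ^ 2 * q ^ 3 ≡ x ^ 2 * q ^ (2 ℕ.* suc s ℕ.+ 1)
  coefficient s = begin
    x * t * (x * t * 1ℚ) * q ^ 3     ≡⟨ regroup x (q ^ 3) t ⟩
    x ^ 2 * (t * t * q ^ 3)          ≡⟨ cong (x ^ 2 *_) (trans (^-+ q (s ℕ.+ s) 3) (cong (_* q ^ 3) (^-+ q s s))) ⟨
    x ^ 2 * q ^ (s ℕ.+ s ℕ.+ 3)      ≡⟨ cong (λ e → x ^ 2 * q ^ e) (exponents s) ⟩
    x ^ 2 * q ^ (2 ℕ.* suc s ℕ.+ 1)  ∎
    where
    open ≡-Reasoning
    t : ℚ
    t = q ^ s
    regroup : ∀ x r t → x * t * (x * t * 1ℚ) * r ≡ x * (x * 1ℚ) * (t * t * r)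
    regroup = solve-∀ ℚ-ring
    exponents : ∀ s → s ℕ.+ s ℕ.+ 3 ≡ 2 ℕ.* suc s ℕ.+ 1
    exponents = ℕ-Solver.solve-∀

  f-recurrence : ∀ k s → f (suc (suc k)) s ≡
    (1ℚ + x * q ^ suc s) * f (suc k) (suc s) - x ^ 2 * q ^ (2 ℕ.* suc s ℕ.+ 1) * f k (suc (suc s))
  f-recurrence k s = trans (Fℤ-recurrence (suc k) (x * q ^ s)) (cong₂ _-_
    (cong₂ (λ y z → (1ℚ + y) * Fℤ (+ suc k) z) (x-shift s) (x-shift s))
    (cong₂ (λ u z → u * Fℤ (+ k) z) (coefficient s) (trans (cong (_* q) (x-shift s)) (x-shift (suc s)))))

  open ThreeTermRecurrence (λ r → 1ℚ + x * q ^ r) (λ r → x ^ 2 * q ^ (2 ℕ.* r ℕ.+ 1)) f (cf x q)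
    (λ s → Fℤ-zero (x * q ^ s)) (λ s → trans (Fℤ-one (x * q ^ s)) (cong (_+_ 1ℚ) (x-shift s))) f-recurrence
    (λ r → refl) (λ r k → refl) public

  T-tails : ∀ k → (∀ r → 2 ≤ r → r ≤ suc k → T (suc k) x q r ≢ 0ℚ) → TailsNonzero 0 k
  T-tails k T≢0 r l 2≤r r+l≡ = subst (λ l′ → cf x q r l′ ≢ 0ℚ) (trans (cong (_∸ r) (sym r+l≡)) (ℕP.m+n∸m≡n r l))
                                     (T≢0 r 2≤r (subst (r ≤_) r+l≡ (ℕP.m≤m+n r l)))

corollary6p2 : (N : ℕ) → 1 ≤ N → (x q : ℚ) → q ≢ 1ℚ → q ≢ - 1ℚ
    → (∀ r → 2 ≤ r → r ≤ N → T N x q r ≢ 0ℚ)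
    → F (N ∸ 1) q (x * q) ≢ 0ℚ
    → F N q x /' F (N ∸ 1) q (x * q) ≡ T N x q 1
corollary6p2 (suc k) _ x q q≢1 q≢-1 T≢0 F≢0 = begin
  F (suc k) q x /' F k q (x * q)         ≡⟨ cong₂ _/'_ (F≡Fℤ q≢root (suc k) x) (F≡Fℤ q≢root k (x * q)) ⟩
  Fℤ (+ suc k) x /' Fℤ (+ k) (x * q)     ≡⟨ cong₂ (λ u v → Fℤ (+ suc k) u /' Fℤ (+ k) (x * v)) (*-identityʳ x) (*-identityʳ q) ⟨
  f (suc k) 0 /' f k 1                   ≡⟨ ratio-continued-fraction k 0 (T-tails k T≢0) f≢0 ⟩
  cf x q 1 k                             ∎
  where
  open ≡-Reasoning
  open Expansion q
  open Shifted x q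
  q≢root : ∀ k → q ^ suc k ≢ 1ℚ
  q≢root = ^-≢1 q q≢1 q≢-1
  f≢0 : f k 1 ≢ 0ℚ
  f≢0 = subst (λ v → Fℤ (+ k) (x * v) ≢ 0ℚ) (sym (*-identityʳ q)) (subst (_≢ 0ℚ) (F≡Fℤ q≢root k (x * q)) F≢0)
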